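{- Let $\mathcal{E},\mathcal{E}'$ be bundle event structures with $\mathcal{E}\trianglelefteq\mathcal{E}'$. Then $\mathcal{T}(\mathcal{E})=\{\alpha\mid\alpha\in\mathcal{T}(\mathcal{E}')\text{ and }\bar\alpha\subseteq E\}$, where $\bar\alpha$ is the set of events occurring in $\alpha$.
   Context: A bundle event structure (BES) is $\mathcal{E}=(E,\#,\mapsto,\lambda,\Phi)$: $E$ a set of events; $\#\subseteq E\times E$ irreflexive symmetric; for $x,y\subseteq E$, $x\#y$ means $e\#f$ for all $e\in x,f\in y$ with $e\neq f$; $\mapsto\subseteq\mathcal{P}(E)\times E$ with $x\mapsto e\Rightarrow x\#x$; $\lambda$ a partial labelling; $\Phi\subseteq E$ with $\Phi\#\Phi$. Let $\mathrm{cfl}(x)=\{e\mid\exists e'\in x:e\#e'\}$. An event trace is a finite sequence $e_1\cdots e_n$ such that for each $i$, $e_i\notin\mathrm{cfl}(\{e_1,\dots,e_{i-1}\})\cup\{e_1,\dots,e_{i-1}\}$ and for each bundle $z\mapsto e_i$ there is $j<i$ with $e_j\in z$; $\mathcal{T}(\mathcal{E})$ is the set of event traces. Sub-BES order: $\mathcal{E}\trianglelefteq\mathcal{E}'$ iff $E\subseteq E'$, $\#=\#'\cap(E\times E)$, $\mapsto\subseteq\mapsto'$, ($x\mapsto'e$ and $e\in E$) implies ($x\subseteq E$ and $x\mapsto e$), $\lambda=\lambda'|_E$, $\Phi=\Phi'\cap E$. -}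

module Defs where

open import Data.Product using (_×_; Σ; ∃; _,_)
open import Data.Unit.Polymorphic using (⊤)
open import Data.Maybe using (Maybe)
open import Data.List using (List; []; _∷_; _++_; [_])
open import Data.List.Relation.Unary.All using (All)
open import Data.List.Relation.Unary.Any using (Any)
open import Data.List.Membership.Propositional using (_∈_)
open import Relation.Nullary using (¬_)
open import Relation.Binary.PropositionalEquality using (_≡_; _≢_)
open import Function.Bundles using (_⇔_)

-- Events are drawn from an ambient type Ev; a BES selects its event set E ⊆ Ev
-- (as a predicate).
-- L is the set of labels; the partial labelling is Ev → Maybe L (only its
-- values on E matter).

Subset : Set → Set₁
Subset Ev = Ev → Set

record BES (Ev L : Set) : Set₁ where
  field
    E    : Subset Ev
    _#_  : Ev → Ev → Set
    _↦_  : Subset Ev → Ev → Set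
    lab  : Ev → Maybe L
    Φ    : Subset Ev
    #-dom   : ∀ e f → e # f → E e × E f
    #-irr   : ∀ e → ¬ (e # e)
    #-sym   : ∀ e f → e # f → f # e
    ↦-dom   : ∀ x e → x ↦ e → (∀ f → x f → E f) × E e
    ↦-cfl   : ∀ x e → x ↦ e → ∀ f g → x f → x g → f ≢ g → f # g
    Φ-dom   : ∀ e → Φ e → E e
    Φ-cfl   : ∀ f g → Φ f → Φ g → f ≢ g → f # g

module _ {Ev L : Set} (𝓔 : BES Ev L) where
  open BES 𝓔

  ValidStep : List Ev → Ev → Set₁
  ValidStep prev e =
    E e × ¬ (e ∈ prev) × All (λ f → ¬ (e # f)) prev
      × (∀ z → z ↦ e → Any z prev)

  TraceFrom : List Ev → List Ev → Set₁
  TraceFrom prev []      = ⊤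
  TraceFrom prev (e ∷ α) = ValidStep prev e × TraceFrom (prev ++ [ e ]) α

  IsTrace : List Ev → Set₁
  IsTrace α = TraceFrom [] α

record _⊴_ {Ev L : Set} (𝓔 𝓔' : BES Ev L) : Set₁ where
  private
    module A = BES 𝓔
    module B = BES 𝓔'
  field
    E⊆    : ∀ e → A.E e → B.E e
    #-res : ∀ e f → (A._#_ e f ⇔ (B._#_ e f × A.E e × A.E f))
    ↦⊆    : ∀ x e → A._↦_ x e → B._↦_ x e
    ↦-ref : ∀ x e → B._↦_ x e → A.E e → (∀ f → x f → A.E f) × A._↦_ x e
    lab-res : ∀ e → A.E e → A.lab e ≡ B.lab e
    Φ-res : ∀ e → (A.Φ e ⇔ (B.Φ e × A.E e))

module Submission where

-- Trace membership is checked one step at a time, so the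
-- whole argument lives at the level of a single step e after a prefix:
--   * conflicts: ⊴ makes #𝓔 the restriction of #𝓔' to E, so a conflict in 𝓔
--     is one in 𝓔'; conversely a conflict in 𝓔' between events of E is one
--     in 𝓔 (this direction needs the prefix to lie in E);
--   * bundles: every 𝓔-bundle is an 𝓔'-bundle, and every 𝓔'-bundle pointing
--     to an event of E is already an 𝓔-bundle.
-- Hence a valid 𝓔-step is a valid 𝓔'-step, and a valid 𝓔'-step to an event
-- of E is a valid 𝓔-step.  Induction along the trace (carrying the
-- invariant that the prefix lies in E) lifts this to TraceFrom, and the
-- proposition is the case of the empty prefix.

open import Defs
open import Data.List using (List; []; _∷_; _++_; [_])
open import Data.List.Relation.Unary.All using (All; []; _∷_)
import Data.List.Relation.Unary.All as All
open import Data.List.Relation.Unary.Any using (Any)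
open import Data.List.Relation.Unary.All.Properties using (++⁺)
open import Data.Product using (_×_; _,_; proj₁; proj₂)
open import Data.Unit.Polymorphic using (tt)
open import Function.Bundles using (_⇔_; mk⇔; Equivalence)
open import Relation.Nullary using (¬_)

module SubBES {Ev L : Set} (𝓔 𝓔' : BES Ev L) (sub : 𝓔 ⊴ 𝓔') where
  private
    module A = BES 𝓔
    module B = BES 𝓔'
  open _⊴_ sub

  #-lift : ∀ {e f} → A._#_ e f → B._#_ e f
  #-lift {e} {f} c = proj₁ (Equivalence.to (#-res e f) c)

  #-restrict : ∀ {e f} → A.E e → A.E f → B._#_ e f → A._#_ e f
  #-restrict {e} {f} Ee Ef c = Equivalence.from (#-res e f) (c , Ee , Ef)

  step-lift : ∀ {prev e} → All A.E prev → ValidStep 𝓔 prev e → ValidStep 𝓔' prev e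
  step-lift {prev} {e} prevE (Ee , fresh , noCfl , bundles) =
    E⊆ e Ee , fresh , noCfl' , bundles'
    where
    noCfl' : All (λ f → ¬ B._#_ e f) prev
    noCfl' = All.zipWith (λ { (Ef , ¬c) c → ¬c (#-restrict Ee Ef c) }) (prevE , noCfl)
    bundles' : ∀ z → B._↦_ z e → Any z prev
    bundles' = λ z z↦e → bundles z (proj₂ (↦-ref z e z↦e Ee))

  step-restrict : ∀ {prev e} → A.E e → ValidStep 𝓔' prev e → ValidStep 𝓔 prev e
  step-restrict {e = e} Ee (_ , fresh , noCfl , bundles) =
    Ee , fresh , All.map (λ ¬c c → ¬c (#-lift c)) noCfl , λ z z↦e → bundles z (↦⊆ z e z↦e)

  trace-lift : ∀ prev α → All A.E prev → TraceFrom 𝓔 prev α →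
               TraceFrom 𝓔' prev α × All A.E α
  trace-lift prev []      _     _ = tt , []
  trace-lift prev (e ∷ α) prevE (step , rest) =
    (step-lift prevE step , proj₁ ih) , proj₁ step ∷ proj₂ ih
    where ih = trace-lift (prev ++ [ e ]) α (++⁺ prevE (proj₁ step ∷ [])) rest

  trace-restrict : ∀ prev α → TraceFrom 𝓔' prev α → All A.E α → TraceFrom 𝓔 prev α
  trace-restrict prev []      _             _          = tt
  trace-restrict prev (e ∷ α) (step , rest) (Ee ∷ αE) =
    step-restrict Ee step , trace-restrict (prev ++ [ e ]) α rest αE

proposition14 : {Ev L : Set} (𝓔 𝓔' : BES Ev L) → 𝓔 ⊴ 𝓔' →
    (α : List Ev) → IsTrace 𝓔 α ⇔ (IsTrace 𝓔' α × All (BES.E 𝓔) α)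
proposition14 𝓔 𝓔' sub α =
  mk⇔ (trace-lift [] α [])
      (λ { (trace , αE) → trace-restrict [] α trace αE })
  where open SubBES 𝓔 𝓔' sub
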